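{- Let $\mathcal{C}$ be a hereditary small graph class. Then its neighborhood complexity satisfies $\nu_{\mathcal{C}}(n) = O(n\log n)$.
   Context: A class of graphs is a set of graphs closed under isomorphism; it is hereditary if closed under taking induced subgraphs. $\mathcal{C}_n$ denotes the set of graphs in $\mathcal{C}$ with vertex set $[n]$; $\mathcal{C}$ is small if there is a constant $c$ with $|\mathcal{C}_n|\le n!\cdot c^n$ for all $n$. For a vertex $v$ of a graph $G$, $N_G(v)$ is its set of neighbors. The neighborhood complexity of $\mathcal{C}$ is the function $\nu_{\mathcal{C}}(n) := \sup_{G\in\mathcal{C},\ A\subseteq V(G),\ |A|=n} |\{N_G(v)\cap A : v\in V(G)\}|$. -}

module Defs where

open import Level using (Level; suc; _⊔_) renaming (zero to lzero)
open import Data.Bool using (Bool; true; false)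
open import Data.Bool.Properties using () renaming (_≟_ to _≟B_)
open import Data.Nat using (ℕ; _≤_; _*_; _^_; _!)

open import Data.Fin using (Fin)
open import Data.Fin.Subset using (Subset; _∩_)
open import Data.Vec using (tabulate)
open import Data.Vec.Properties using (≡-dec)
open import Data.List using (List; map; length; deduplicate; allFin)
open import Data.Product using (Σ; ∃; _×_; _,_)
open import Function.Definitions using (Injective)
open import Relation.Binary.PropositionalEquality using (_≡_)

record Graph (n : ℕ) : Set where
  field
    adj    : Fin n → Fin n → Bool
    sym    : ∀ u v → adj u v ≡ adj v u
    irrefl : ∀ v → adj v v ≡ false
open Graph public

SameGraph : ∀ {n} → Graph n → Graph n → Set
SameGraph G H = ∀ u v → adj G u v ≡ adj H u v

induce : ∀ {k n} → Graph n → (Fin k → Fin n) → Graph k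
induce G ι = record
  { adj = λ u v → adj G (ι u) (ι v)
  ; sym = λ u v → sym G (ι u) (ι v)
  ; irrefl = λ v → irrefl G (ι v) }

IsIso : ∀ {n m} → Graph n → Graph m → (Fin n → Fin m) → (Fin m → Fin n) → Set
IsIso G H σ τ =
  (∀ x → τ (σ x) ≡ x) × (∀ y → σ (τ y) ≡ y) ×
  (∀ u v → adj H (σ u) (σ v) ≡ adj G u v)

record GraphClass : Set₁ where
  field
    member   : ∀ {n} → Graph n → Set
    isoClosed : ∀ {n m} (G : Graph n) (H : Graph m) σ τ →
                IsIso G H σ τ → member G → member H
open GraphClass public

Hereditary : GraphClass → Set
Hereditary C = ∀ {k n} (G : Graph n) (ι : Fin k → Fin n) →
  Injective _≡_ _≡_ ι → member C G → member C (induce G ι)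

Cn : GraphClass → ℕ → Set
Cn C n = Σ (Graph n) (member C)

CardLe : GraphClass → ℕ → ℕ → Set
CardLe C n N = Σ (Cn C n → Fin N) λ f →
  ∀ (x y : Cn C n) → f x ≡ f y → SameGraph (Σ.proj₁ x) (Σ.proj₁ y)

Small : GraphClass → Set
Small C = ∃ λ c → ∀ n → CardLe C n ((n !) * (c ^ n))

nbhd : ∀ {m} → Graph m → Fin m → Subset m
nbhd G v = tabulate (adj G v)

traceCount : ∀ {m} → Graph m → Subset m → ℕ
traceCount {m} G A =
  length (deduplicate (≡-dec _≟B_) (map (λ v → nbhd G v ∩ A) (allFin m)))

module Submission where

-- Fix A with |A| = n, and choose one vertex outside A for each trace on A that no vertex of A
-- realises; say there are k of them. Any s of these, taken in order and adjoined to A, induce a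
-- graph of C on n + s vertices from which the ordered tuple can be read back, because each chosen
-- vertex is identified by its adjacencies to A. Hence k (k-1) ... (k-s+1) <= |C_(n+s)| <= (n+s)! c^(n+s),
-- and taking s = n log₂ n forces k = O(n log n). The traces realised inside A add at most n.

open import Defs hiding (sym)
open import Data.Nat
open import Data.Nat.Properties
  using ( ≤-refl; ≤-trans; <⇒≤; <⇒≱; ≰⇒>; ≮⇒≥; <-irrefl; n≤1+n; m≤n⇒m≤1+n; m≤m+n; m≤n+m∸n; m∸n≤m
        ; +-comm; +-suc; +-mono-≤; +-monoˡ-≤; +-monoʳ-≤; *-mono-≤; *-monoˡ-≤; *-monoʳ-≤; m≤m*n
        ; ^-*-assoc; ^-monoˡ-≤; ^-monoˡ-<; m^n≢0; m^n>0; module ≤-Reasoning)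
open import Data.Nat.Logarithm using (⌊log₂_⌋; ⌊log₂⌋-mono-≤; ⌊log₂[2^n]⌋≡n)
open import Data.Nat.Tactic.RingSolver using (solve-∀)
open import Data.Bool using (true; false; _∧_)
open import Data.Bool.Properties using (∧-zeroʳ) renaming (_≟_ to _≟B_)
open import Data.Fin using (Fin; zero; suc; punchIn; remQuot; combine; splitAt; join; _↑ˡ_; _↑ʳ_)
open import Data.Fin.Properties
  using (suc-injective; punchIn-injective; punchInᵢ≢i; combine-remQuot; join-splitAt; splitAt-↑ˡ; splitAt-↑ʳ; injective⇒≤; any?)
open import Data.Fin.Subset using (Subset; ∣_∣; _∈_; _∉_; inside; outside; _∩_)
open import Data.Vec using ([]; _∷_; here; there; lookup)
open import Data.Vec.Properties using (lookup∘tabulate; ≡-dec)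
open import Data.List as List using (List; []; _∷_; length; filter; map; allFin; deduplicate)
open import Data.List.Membership.Propositional using () renaming (_∈_ to _∈ₗ_)
open import Data.List.Membership.Propositional.Properties using (∈-lookup; ∈-map⁻; ∈-filter⁻; ∈-deduplicate⁻)
open import Data.List.Relation.Unary.All as All using ()
open import Data.List.Relation.Unary.AllPairs using (_∷_)
open import Data.List.Relation.Unary.Unique.Propositional using (Unique)
open import Data.List.Relation.Unary.Unique.Propositional.Properties using (filter⁺)
open import Data.List.Relation.Unary.Unique.DecPropositional.Properties using (deduplicate-!)
open import Data.Product using (∃; ∃₂; _×_; _,_; proj₁; proj₂; uncurry)
open import Data.Product.Properties using (×-≡,≡→≡)
open import Data.Sum using (inj₁; inj₂; [_,_]′)
open import Function using (_∘_)
open import Function.Definitions using (Injective)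
open import Level using (0ℓ)
open import Relation.Binary using (DecidableEquality)
open import Relation.Binary.PropositionalEquality
open import Relation.Nullary using (yes; no; does; contradiction)
open import Relation.Unary using (Pred; Decidable)
open import Relation.Unary.Properties using (∁?)

private variable
  k m n s : ℕ

fallingFactorial : ℕ → ℕ → ℕ
fallingFactorial k       zero    = 1
fallingFactorial zero    (suc s) = 0
fallingFactorial (suc k) (suc s) = suc k * fallingFactorial k s

fallingFactorial-lowerBound : ∀ k s → (k ∸ s) ^ s ≤ fallingFactorial k s
fallingFactorial-lowerBound k       zero    = ≤-refl
fallingFactorial-lowerBound zero    (suc s) = ≤-refl
fallingFactorial-lowerBound (suc k) (suc s) =
  *-mono-≤ (m≤n⇒m≤1+n (m∸n≤m k s)) (fallingFactorial-lowerBound k s)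

n!≤n^n : ∀ n → n ! ≤ n ^ n
n!≤n^n zero    = ≤-refl
n!≤n^n (suc n) = *-monoʳ-≤ (suc n) (≤-trans (n!≤n^n n) (^-monoˡ-≤ n (n≤1+n n)))

^-distribʳ-* : ∀ m n o → (m * n) ^ o ≡ m ^ o * n ^ o
^-distribʳ-* m n zero    = refl
^-distribʳ-* m n (suc o) = begin
  m * n * (m * n) ^ o       ≡⟨ cong (m * n *_) (^-distribʳ-* m n o) ⟩
  m * n * (m ^ o * n ^ o)   ≡⟨ interchange m n (m ^ o) (n ^ o) ⟩
  m * m ^ o * (n * n ^ o)   ∎
  where
  open ≡-Reasoning
  interchange : ∀ a b c d → a * b * (c * d) ≡ a * c * (b * d)
  interchange = solve-∀

^-cancelʳ-≤ : ∀ o .{{_ : NonZero o}} {m n} → m ^ o ≤ n ^ o → m ≤ n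
^-cancelʳ-≤ o {m} {n} m^o≤n^o with m ≤? n
... | yes m≤n = m≤n
... | no  m≰n = contradiction m^o≤n^o (<⇒≱ (^-monoˡ-< o (≰⇒> m≰n)))

m≤m^n : ∀ m n .{{_ : NonZero n}} → m ≤ m ^ n
m≤m^n zero    (suc n) = z≤n
m≤m^n (suc m) (suc n) = m≤m*n (suc m) (suc m ^ n) {{m^n≢0 (suc m) n}}

1+n≤2^n : ∀ n → 1 + n ≤ 2 ^ n
1+n≤2^n zero    = ≤-refl
1+n≤2^n (suc n) = +-mono-≤ (m^n>0 2 n) (≤-trans (1+n≤2^n n) (m≤m+n (2 ^ n) 0))

2≤n⇒1≤⌊log₂n⌋ : ∀ {n} → 2 ≤ n → 1 ≤ ⌊log₂ n ⌋
2≤n⇒1≤⌊log₂n⌋ {n} 2≤n = subst (_≤ ⌊log₂ n ⌋) (⌊log₂[2^n]⌋≡n 1) (⌊log₂⌋-mono-≤ 2≤n)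

n<2^[1+⌊log₂n⌋] : ∀ n → n < 2 ^ suc ⌊log₂ n ⌋
n<2^[1+⌊log₂n⌋] n with n <? 2 ^ suc ⌊log₂ n ⌋
... | yes n<2^[1+L] = n<2^[1+L]
... | no  n≮2^[1+L] = contradiction
  (subst (_≤ ⌊log₂ n ⌋) (⌊log₂[2^n]⌋≡n (suc ⌊log₂ n ⌋)) (⌊log₂⌋-mono-≤ (≮⇒≥ n≮2^[1+L])))
  (<-irrefl refl)

[1+L]*n*c≤[8c]^L : ∀ c n L → 1 ≤ L → n < 2 ^ suc L → suc L * n * suc c ≤ (8 * suc c) ^ L
[1+L]*n*c≤[8c]^L c n L@(suc _) _ n<2^[1+L] = begin
  suc L * n * suc c                  ≤⟨ *-mono-≤ (*-mono-≤ (1+n≤2^n L) (<⇒≤ n<2^[1+L])) (m≤m^n (suc c) L) ⟩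
  2 ^ L * (2 * 2 ^ L) * suc c ^ L    ≤⟨ *-monoˡ-≤ (suc c ^ L) (*-monoʳ-≤ (2 ^ L) (*-monoˡ-≤ (2 ^ L) (m≤m^n 2 L))) ⟩
  2 ^ L * (2 ^ L * 2 ^ L) * suc c ^ L ≡⟨ cong (_* suc c ^ L) (sym (^-distribʳ-*³ L)) ⟩
  8 ^ L * suc c ^ L                  ≡⟨ sym (^-distribʳ-* 8 (suc c) L) ⟩
  (8 * suc c) ^ L                    ∎
  where
  open ≤-Reasoning
  ^-distribʳ-*³ : ∀ L → 8 ^ L ≡ 2 ^ L * (2 ^ L * 2 ^ L)
  ^-distribʳ-*³ L = trans (^-distribʳ-* 2 4 L) (cong (2 ^ L *_) (^-distribʳ-* 2 2 L))

-- With L = ⌊log₂ n⌋ and s = L n, the bound (k - s)^s ≤ (n + s)! c^(n+s), after taking the n-th root,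
-- leaves (k - s)^L ≤ ((1+L) n c)^(1+L), and (1+L) n c ≤ (8c)^L absorbs the extra factor.
k∸Ln≤8c·[1+L]nc : ∀ c n k → 2 ≤ n → let L = ⌊log₂ n ⌋ in
  fallingFactorial k (L * n) ≤ (n + L * n) ! * suc c ^ (n + L * n) →
  k ∸ L * n ≤ 8 * suc c * (suc L * n * suc c)
k∸Ln≤8c·[1+L]nc c n@(suc _) k 2≤n bound = ^-cancelʳ-≤ L {{>-nonZero 1≤L}} q^L≤[8cX]^L
  where
  L = ⌊log₂ n ⌋
  1≤L = 2≤n⇒1≤⌊log₂n⌋ 2≤n
  q = k ∸ L * n
  X = suc L * n * suc c
  open ≤-Reasoning
  [q^L]^n≤[X^[1+L]]^n : (q ^ L) ^ n ≤ (X ^ suc L) ^ n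
  [q^L]^n≤[X^[1+L]]^n = begin
    (q ^ L) ^ n                             ≡⟨ ^-*-assoc q L n ⟩
    q ^ (L * n)                             ≤⟨ fallingFactorial-lowerBound k (L * n) ⟩
    fallingFactorial k (L * n)              ≤⟨ bound ⟩
    (n + L * n) ! * suc c ^ (n + L * n)     ≤⟨ *-monoˡ-≤ _ (n!≤n^n (n + L * n)) ⟩
    (n + L * n) ^ (n + L * n) * suc c ^ (n + L * n) ≡⟨ sym (^-distribʳ-* (n + L * n) (suc c) (n + L * n)) ⟩
    X ^ (suc L * n)                         ≡⟨ sym (^-*-assoc X (suc L) n) ⟩
    (X ^ suc L) ^ n                         ∎
  q^L≤[8cX]^L : q ^ L ≤ (8 * suc c * X) ^ L
  q^L≤[8cX]^L = begin
    q ^ L                   ≤⟨ ^-cancelʳ-≤ n [q^L]^n≤[X^[1+L]]^n ⟩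
    X * X ^ L               ≤⟨ *-monoˡ-≤ (X ^ L) ([1+L]*n*c≤[8c]^L c n L 1≤L (n<2^[1+⌊log₂n⌋] n)) ⟩
    (8 * suc c) ^ L * X ^ L ≡⟨ sym (^-distribʳ-* (8 * suc c) X L) ⟩
    (8 * suc c * X) ^ L     ∎

fallingFactorial-bounded⇒≤n·log₂n : ∀ c n k → 2 ≤ n →
  (∀ s → fallingFactorial k s ≤ (n + s) ! * suc c ^ (n + s)) →
  k + n ≤ (16 * suc c * suc c + 2) * n * ⌊log₂ n ⌋
fallingFactorial-bounded⇒≤n·log₂n c n k 2≤n bound
  with ⌊log₂ n ⌋ | 2≤n⇒1≤⌊log₂n⌋ 2≤n | k∸Ln≤8c·[1+L]nc c n k 2≤n (bound _)
... | suc L′ | s≤s z≤n | q≤ = begin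
  k + n                                              ≤⟨ +-monoˡ-≤ n (m≤n+m∸n k (suc L′ * n)) ⟩
  suc L′ * n + (k ∸ suc L′ * n) + n                  ≤⟨ +-monoˡ-≤ n (+-monoʳ-≤ (suc L′ * n) q≤) ⟩
  suc L′ * n + 8 * suc c * (suc (suc L′) * n * suc c) + n ≤⟨ m≤m+n _ _ ⟩
  suc L′ * n + 8 * suc c * (suc (suc L′) * n * suc c) + n + (8 * suc c * suc c * n * L′ + n * L′)
                                                     ≡⟨ expand (suc c) n L′ ⟩
  (16 * suc c * suc c + 2) * n * suc L′              ∎
  where
  open ≤-Reasoning
  expand : ∀ c n L′ → (1 + L′) * n + 8 * c * ((2 + L′) * n * c) + n + (8 * c * c * n * L′ + n * L′)
                      ≡ (16 * c * c + 2) * n * (1 + L′)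
  expand = solve-∀

∩-congˡ-on : (p q r : Subset n) → (∀ x → x ∈ r → lookup p x ≡ lookup q x) → p ∩ r ≡ q ∩ r
∩-congˡ-on []      []      []            _ = refl
∩-congˡ-on (a ∷ p) (b ∷ q) (outside ∷ r) h =
  cong₂ _∷_ (trans (∧-zeroʳ a) (sym (∧-zeroʳ b))) (∩-congˡ-on p q r λ x → h (suc x) ∘ there)
∩-congˡ-on (a ∷ p) (b ∷ q) (inside ∷ r)  h =
  cong₂ _∷_ (cong (_∧ true) (h zero here)) (∩-congˡ-on p q r λ x → h (suc x) ∘ there)

record Enumeration (A : Subset m) : Set where
  field
    elem            : Fin ∣ A ∣ → Fin m
    elem-injective  : Injective _≡_ _≡_ elem
    elem∈           : ∀ i → elem i ∈ A
    elem-surjective : ∀ {x} → x ∈ A → ∃ λ i → elem i ≡ x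

enumerate : (A : Subset m) → Enumeration A
enumerate [] = record
  { elem = λ () ; elem-injective = λ {} ; elem∈ = λ () ; elem-surjective = λ () }
enumerate (outside ∷ A) = record
  { elem            = suc ∘ elem
  ; elem-injective  = elem-injective ∘ suc-injective
  ; elem∈           = there ∘ elem∈
  ; elem-surjective = λ { (there x∈A) → let i , eᵢ≡x = elem-surjective x∈A in i , cong suc eᵢ≡x }
  }
  where open Enumeration (enumerate A)
enumerate {suc m} (inside ∷ A) = record
  { elem = elem′ ; elem-injective = elem′-injective ; elem∈ = elem′∈ ; elem-surjective = elem′-surjective }
  where
  open Enumeration (enumerate A)
  elem′ : Fin (suc ∣ A ∣) → Fin (suc m)
  elem′ zero    = zero
  elem′ (suc i) = suc (elem i)
  elem′-injective : Injective _≡_ _≡_ elem′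
  elem′-injective {zero}  {zero}  _ = refl
  elem′-injective {suc i} {suc j} e = cong suc (elem-injective (suc-injective e))
  elem′∈ : ∀ i → elem′ i ∈ (inside ∷ A)
  elem′∈ zero    = here
  elem′∈ (suc i) = there (elem∈ i)
  elem′-surjective : ∀ {x} → x ∈ (inside ∷ A) → ∃ λ i → elem′ i ≡ x
  elem′-surjective here          = zero , refl
  elem′-surjective (there x∈A) = let i , eᵢ≡x = elem-surjective x∈A in suc i , cong suc eᵢ≡x

[,]-injective : ∀ {a b c} {A : Set a} {B : Set b} {C : Set c} {f : A → C} {g : B → C} →
  Injective _≡_ _≡_ f → Injective _≡_ _≡_ g → (∀ a b → f a ≢ g b) → Injective _≡_ _≡_ [ f , g ]′
[,]-injective f-inj _     _        {inj₁ _} {inj₁ _} e = cong inj₁ (f-inj e)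
[,]-injective _     _     disjoint {inj₁ a} {inj₂ b} e = contradiction e (disjoint a b)
[,]-injective _     _     disjoint {inj₂ b} {inj₁ a} e = contradiction (sym e) (disjoint a b)
[,]-injective _     g-inj _        {inj₂ _} {inj₂ _} e = cong inj₂ (g-inj e)

splitAt-injective : ∀ m {n} → Injective _≡_ _≡_ (splitAt m {n})
splitAt-injective m {n} {i} {j} e =
  trans (sym (join-splitAt m n i)) (trans (cong (join m n) e) (join-splitAt m n j))

remQuot-injective : ∀ {n} k → Injective _≡_ _≡_ (remQuot {n} k)
remQuot-injective {n} k {i} {j} e =
  trans (sym (combine-remQuot {n} k i)) (trans (cong (uncurry combine) e) (combine-remQuot {n} k j))

module _ {a} {A : Set a} where

  lookup-injective : ∀ {xs : List A} → Unique xs → ∀ {i j} → List.lookup xs i ≡ List.lookup xs j → i ≡ j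
  lookup-injective (_    ∷ _) {zero}  {zero}  _ = refl
  lookup-injective (x≢xs ∷ _) {zero}  {suc j} e = contradiction e (All.lookup x≢xs (∈-lookup j))
  lookup-injective (x≢xs ∷ _) {suc i} {zero}  e = contradiction (sym e) (All.lookup x≢xs (∈-lookup i))
  lookup-injective (_    ∷ u) {suc _} {suc _} e = cong suc (lookup-injective u e)

  length-filter+∁ : ∀ {ℓ} {P : Pred A ℓ} (P? : Decidable P) xs →
                    length (filter P? xs) + length (filter (∁? P?) xs) ≡ length xs
  length-filter+∁ P? []       = refl
  length-filter+∁ P? (x ∷ xs) with does (P? x)
  ... | true  = cong suc (length-filter+∁ P? xs)
  ... | false = trans (+-suc _ _) (cong suc (length-filter+∁ P? xs))

punchIn-cons : Fin (suc k) → (Fin s → Fin k) → Fin (suc s) → Fin (suc k)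
punchIn-cons i t zero    = i
punchIn-cons i t (suc j) = punchIn i (t j)

punchIn-cons-injective : ∀ {i} {t : Fin s → Fin k} → Injective _≡_ _≡_ t →
                         Injective _≡_ _≡_ (punchIn-cons i t)
punchIn-cons-injective _ {zero}  {zero}  _ = refl
punchIn-cons-injective _ {zero}  {suc _} e = contradiction (sym e) (punchInᵢ≢i _ _)
punchIn-cons-injective _ {suc _} {zero}  e = contradiction e (punchInᵢ≢i _ _)
punchIn-cons-injective t-inj {suc _} {suc _} e = cong suc (t-inj (punchIn-injective _ _ _ e))

punchIn-cons-cancel : ∀ {i i′} {t t′ : Fin s → Fin k} →
  (∀ j → punchIn-cons i t j ≡ punchIn-cons i′ t′ j) → i ≡ i′ × (∀ j → t j ≡ t′ j)
punchIn-cons-cancel {i = i} h =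
  h zero , λ j → punchIn-injective i _ _ (trans (h (suc j)) (cong (λ i′ → punchIn i′ _) (sym (h zero))))

-- The p-th injective s-tuple of elements of Fin k: the first entry and the code of the rest
-- are read off p as a mixed-radix numeral, the rest is then punched around the first entry.
arrangement : ∀ k s → Fin (fallingFactorial k s) → Fin s → Fin k
arrangement k       zero    p      ()
arrangement zero    (suc s) ()
arrangement (suc k) (suc s) p =
  let i , q = remQuot (fallingFactorial k s) p in punchIn-cons i (arrangement k s q)

arrangement-injective : ∀ k s p → Injective _≡_ _≡_ (arrangement k s p)
arrangement-injective k       zero    p {()}
arrangement-injective zero    (suc s) ()
arrangement-injective (suc k) (suc s) p = punchIn-cons-injective (arrangement-injective k s _)

arrangement-≗⇒≡ : ∀ k s {p p′} → (∀ j → arrangement k s p j ≡ arrangement k s p′ j) → p ≡ p′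
arrangement-≗⇒≡ k       zero    {zero} {zero} _ = refl
arrangement-≗⇒≡ zero    (suc s) {()}
arrangement-≗⇒≡ (suc k) (suc s) h =
  let i≡i′ , t≗t′ = punchIn-cons-cancel h in
  remQuot-injective (fallingFactorial k s) (×-≡,≡→≡ (i≡i′ , arrangement-≗⇒≡ k s t≗t′))

trace : Graph m → Subset m → Fin m → Subset m
trace G A v = nbhd G v ∩ A

trace-cong : ∀ (G : Graph m) A {v v′} → (∀ x → x ∈ A → adj G v x ≡ adj G v′ x) →
             trace G A v ≡ trace G A v′
trace-cong G A {v} {v′} h = ∩-congˡ-on (nbhd G v) (nbhd G v′) A λ x x∈A →
  trans (lookup∘tabulate (adj G v) x) (trans (h x x∈A) (sym (lookup∘tabulate (adj G v′) x)))

record OuterTraceFamily (G : Graph m) (A : Subset m) : Set where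
  field
    size            : ℕ
    vertex          : Fin size → Fin m
    vertex∉A        : ∀ i → vertex i ∉ A
    traces-distinct : Injective _≡_ _≡_ (trace G A ∘ vertex)

  vertex-injective : Injective _≡_ _≡_ vertex
  vertex-injective = traces-distinct ∘ cong (trace G A)

module _ (G : Graph m) (A : Subset m) where
  open Enumeration (enumerate A)

  private
    _≟ₛ_ : DecidableEquality (Subset m)
    _≟ₛ_ = ≡-dec _≟B_

    traces : List (Subset m)
    traces = deduplicate _≟ₛ_ (map (trace G A) (allFin m))

    traces-unique : Unique traces
    traces-unique = deduplicate-! _≟ₛ_ (map (trace G A) (allFin m))

    IsInnerTrace : Pred (Subset m) 0ℓ
    IsInnerTrace y = ∃ λ i → y ≡ trace G A (elem i)

    inner? : Decidable IsInnerTrace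
    inner? y = any? λ i → y ≟ₛ trace G A (elem i)

    inner outer : List (Subset m)
    inner = filter inner? traces
    outer = filter (∁? inner?) traces

    realized : ∀ {y} → y ∈ₗ traces → ∃ λ v → y ≡ trace G A v
    realized y∈traces =
      let v , _ , y≡ = ∈-map⁻ (trace G A) (∈-deduplicate⁻ _≟ₛ_ _ y∈traces) in v , y≡

    outer-realized : ∀ i → ∃ λ v → v ∉ A × List.lookup outer i ≡ trace G A v
    outer-realized i with ∈-filter⁻ (∁? inner?) {xs = traces} (∈-lookup i)
    ... | y∈traces , ¬inner with realized y∈traces
    ...   | v , y≡ = v , v∉A , y≡
      where
      v∉A : v ∉ A
      v∉A v∈A = let j , eⱼ≡v = elem-surjective v∈A in ¬inner (j , trans y≡ (cong (trace G A) (sym eⱼ≡v)))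

    length-inner≤ : length inner ≤ ∣ A ∣
    length-inner≤ = injective⇒≤ {f = witness} λ {i} {j} e →
      lookup-injective (filter⁺ inner? traces-unique)
        (trans (proj₂ (inner-realized i)) (trans (cong (trace G A ∘ elem) e) (sym (proj₂ (inner-realized j)))))
      where
      inner-realized : ∀ i → IsInnerTrace (List.lookup inner i)
      inner-realized i = proj₂ (∈-filter⁻ inner? {xs = traces} (∈-lookup i))
      witness : Fin (length inner) → Fin ∣ A ∣
      witness = proj₁ ∘ inner-realized

  outerTraceFamily : OuterTraceFamily G A
  outerTraceFamily = record
    { size            = length outer
    ; vertex          = proj₁ ∘ outer-realized
    ; vertex∉A        = proj₁ ∘ proj₂ ∘ outer-realized
    ; traces-distinct = λ {i} {j} e → lookup-injective (filter⁺ (∁? inner?) traces-unique)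
        (trans (proj₂ (proj₂ (outer-realized i))) (trans e (sym (proj₂ (proj₂ (outer-realized j))))))
    }

  traceCount≤outer+∣A∣ : traceCount G A ≤ OuterTraceFamily.size outerTraceFamily + ∣ A ∣
  traceCount≤outer+∣A∣ = begin
    traceCount G A                ≡⟨ length-filter+∁ inner? traces ⟨
    length inner + length outer   ≡⟨ +-comm (length inner) (length outer) ⟩
    length outer + length inner   ≤⟨ +-monoʳ-≤ (length outer) length-inner≤ ⟩
    length outer + ∣ A ∣          ∎
    where open ≤-Reasoning

module _ (C : GraphClass) (hereditary : Hereditary C) {c : ℕ}
         (small : ∀ n → CardLe C n (n ! * c ^ n))
         {G : Graph m} (G∈C : member C G) {A : Subset m} (T : OuterTraceFamily G A) where

  open Enumeration (enumerate A)
  open OuterTraceFamily T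

  module _ (s : ℕ) where

    embedding : Fin (fallingFactorial size s) → Fin (∣ A ∣ + s) → Fin m
    embedding p = [ elem , vertex ∘ arrangement size s p ]′ ∘ splitAt ∣ A ∣

    embedding-↑ˡ : ∀ p i → embedding p (i ↑ˡ s) ≡ elem i
    embedding-↑ˡ p i = cong [ elem , vertex ∘ arrangement size s p ]′ (splitAt-↑ˡ ∣ A ∣ i s)

    embedding-↑ʳ : ∀ p j → embedding p (∣ A ∣ ↑ʳ j) ≡ vertex (arrangement size s p j)
    embedding-↑ʳ p j = cong [ elem , vertex ∘ arrangement size s p ]′ (splitAt-↑ʳ ∣ A ∣ s j)

    embedding-injective : ∀ p → Injective _≡_ _≡_ (embedding p)
    embedding-injective p = splitAt-injective ∣ A ∣
      ∘ [,]-injective elem-injective (arrangement-injective size s p ∘ vertex-injective) elem≢vertex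
      where
      elem≢vertex : ∀ i j → elem i ≢ vertex (arrangement size s p j)
      elem≢vertex i j e = vertex∉A _ (subst (_∈ A) e (elem∈ i))

    inducedGraph : Fin (fallingFactorial size s) → Cn C (∣ A ∣ + s)
    inducedGraph p = induce G (embedding p) , hereditary G (embedding p) (embedding-injective p) G∈C

    inducedGraph-injective : ∀ p q → SameGraph (proj₁ (inducedGraph p)) (proj₁ (inducedGraph q)) → p ≡ q
    inducedGraph-injective p q same = arrangement-≗⇒≡ size s λ j →
      traces-distinct (trace-cong G A λ x x∈A →
        let i , eᵢ≡x = elem-surjective x∈A in subst (λ x → adj G _ x ≡ adj G _ x) eᵢ≡x (adj-elem j i))
      where
      adj-elem : ∀ j i → adj G (vertex (arrangement size s p j)) (elem i)
                       ≡ adj G (vertex (arrangement size s q j)) (elem i)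
      adj-elem j i = begin
        adj G (vertex (arrangement size s p j)) (elem i)      ≡⟨ cong₂ (adj G) (embedding-↑ʳ p j) (embedding-↑ˡ p i) ⟨
        adj G (embedding p (∣ A ∣ ↑ʳ j)) (embedding p (i ↑ˡ s)) ≡⟨ same (∣ A ∣ ↑ʳ j) (i ↑ˡ s) ⟩
        adj G (embedding q (∣ A ∣ ↑ʳ j)) (embedding q (i ↑ˡ s)) ≡⟨ cong₂ (adj G) (embedding-↑ʳ q j) (embedding-↑ˡ q i) ⟩
        adj G (vertex (arrangement size s q j)) (elem i)      ∎
        where open ≡-Reasoning

    fallingFactorial-size≤ : fallingFactorial size s ≤ (∣ A ∣ + s) ! * c ^ (∣ A ∣ + s)
    fallingFactorial-size≤ with small (∣ A ∣ + s)
    ... | code , code-injective = injective⇒≤ {f = code ∘ inducedGraph} λ {p} {q} e →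
      inducedGraph-injective p q (code-injective (inducedGraph p) (inducedGraph q) e)

theorem1p4 : (C : GraphClass) → Hereditary C → Small C →
    ∃₂ λ (c n₀ : ℕ) → ∀ (n : ℕ) → n₀ ≤ n →
      ∀ {m} (G : Graph m) → member C G → (A : Subset m) → ∣ A ∣ ≡ n →
        traceCount G A ≤ c * n * ⌊log₂ n ⌋
theorem1p4 C hereditary (c , small) = 16 * suc c * suc c + 2 , 2 , bound
  where
  bound : ∀ n → 2 ≤ n → ∀ {m} (G : Graph m) → member C G → (A : Subset m) → ∣ A ∣ ≡ n →
          traceCount G A ≤ (16 * suc c * suc c + 2) * n * ⌊log₂ n ⌋
  bound n 2≤n G G∈C A refl = ≤-trans (traceCount≤outer+∣A∣ G A)
    (fallingFactorial-bounded⇒≤n·log₂n c n _ 2≤n λ s →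
      ≤-trans (fallingFactorial-size≤ C hereditary small G∈C (outerTraceFamily G A) s)
              (*-monoʳ-≤ ((n + s) !) (^-monoˡ-≤ (n + s) (n≤1+n c))))
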